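{- For integers $k,l\ge 0$ define \[A(k,l)=\{(x_1,\dots,x_k)\in\mathbb{Z}^k: 1\le x_1<\cdots<x_k,\ x_1+\cdots+x_k=l\},\] \[B(k,l)=\{(x_1,\dots,x_k)\in\mathbb{Z}^k: 0\le x_1<\cdots<x_k,\ x_1+\cdots+x_k=l\}.\] Then for every integer $n\ge 0$, \[p(n)=\sum_{0\le k\le l\le n}|A(k,l)|\,|B(k,n-l)|=\sum_{0\le k\le l\le n}|B(k,l-k)|\,|B(k,n-l)|,\] where $p(n)$ is the number of partitions of $n$ (with $p(0)=1$).
   Context: For $k=0$, $\mathbb{Z}^0$ consists of the single empty tuple, whose sum is $0$; thus $A(0,l)$ and $B(0,l)$ each have one element if $l=0$ and are empty otherwise. -}

module Defs where

open import Data.Nat using (ℕ; zero; suc; _+_; _∸_; _≥_)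
open import Data.Integer as ℤ using (ℤ; +_)
open import Data.Vec using (Vec; []; _∷_; foldr)
open import Data.List using (List)
open import Data.Nat.ListAction using (sum)
open import Data.List.Relation.Unary.All using (All)
open import Data.List.Relation.Unary.Linked using (Linked)
open import Data.Product using (Σ; _×_)
open import Relation.Binary.PropositionalEquality using (_≡_)

data StrictlyIncreasing : {k : ℕ} → Vec ℤ k → Set where
  []-inc  : StrictlyIncreasing []
  [-]-inc : ∀ {x} → StrictlyIncreasing (x ∷ [])
  ∷-inc   : ∀ {k x y} {xs : Vec ℤ k} →
            x ℤ.< y → StrictlyIncreasing (y ∷ xs) → StrictlyIncreasing (x ∷ y ∷ xs)

data FirstAtLeast (m : ℤ) : {k : ℕ} → Vec ℤ k → Set where
  []-fst : FirstAtLeast m []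
  ∷-fst  : ∀ {k x} {xs : Vec ℤ k} → m ℤ.≤ x → FirstAtLeast m (x ∷ xs)

vsum : {k : ℕ} → Vec ℤ k → ℤ
vsum = foldr _ ℤ._+_ (+ 0)

A : ℕ → ℕ → Set
A k l = Σ (Vec ℤ k) λ x → FirstAtLeast (+ 1) x × StrictlyIncreasing x × vsum x ≡ + l

B : ℕ → ℕ → Set
B k l = Σ (Vec ℤ k) λ x → FirstAtLeast (+ 0) x × StrictlyIncreasing x × vsum x ≡ + l

Partition : ℕ → Set
Partition n = Σ (List ℕ) λ xs → All (λ x → x ≥ 1) xs × Linked _≥_ xs × sum xs ≡ n

Σ≤ : ℕ → (ℕ → ℕ) → ℕ
Σ≤ zero f = f 0
Σ≤ (suc n) f = Σ≤ n f + f (suc n)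

Σkl : ℕ → (ℕ → ℕ → ℕ) → ℕ
Σkl n g = Σ≤ n λ l → Σ≤ l λ k → g k l

module Submission where

-- Durfee squares.  A partition whose Durfee square has side k consists of its first k
-- parts, all ≥ k, followed by a partition into parts ≤ k.  Both pieces are encoded by
-- vectors g ∈ ℕᵏ of weight k g₁ + (k−1) g₂ + ⋯ + g_k: the first by the successive
-- differences of its rows (on top of the k × k square), the second by multiplicities.
-- The gaps g of a strictly increasing sequence c ≤ x₁ < ⋯ < x_k give the same weight,
-- the sum being that weight + k c + k(k−1)/2.  Since k² = (k + k(k−1)/2) + k(k−1)/2,
-- splitting the square between the two pieces matches the partitions of n of Durfee
-- side k with the pairs in A(k,l) × B(k,n−l), l ≤ n; and A(k,l) ≅ B(k,l−k) by shifting
-- every entry down by one.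

open import Data.Nat using (ℕ; zero; suc; _+_; _*_; _∸_; _≤_; _≥_; z≤n; s≤s)
open import Data.Nat.Properties
  using (_≟_; _≤?_; ≤-refl; ≤-trans; ≤-pred; ≤-irrelevant; ≡-irrelevant; ≤∧≢⇒<; 1+n≰n; <⇒≱; ≮⇒≥;
         m≤n⇒m≤1+n; m≤m+n; m≤n+m; m+[n∸m]≡n; m+n∸m≡n; m+n∸n≡m; m∸n+n≡m;
         +-identityʳ; +-suc; +-cancelˡ-≤; *-comm; *-identityʳ)
open import Data.Nat.Tactic.RingSolver using (solve-∀)
open import Data.Nat.ListAction using (sum)
open import Data.Nat.ListAction.Properties using (sum-++; sum-↭)
open import Data.Integer as ℤ using (ℤ; +_; +≤+; +<+)
import Data.Integer.Properties as ℤ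
open import Data.Vec using (Vec; []; _∷_; toList; reverse; _∷ʳ_)
open import Data.Vec.Properties using (reverse-∷; reverse-involutive; toList-reverse)
open import Data.List using (List; []; _∷_; _++_; replicate)
open import Data.List.Properties using (∷-injective)
open import Data.List.Relation.Binary.Permutation.Propositional.Properties using (↭-reverse)
open import Data.List.Relation.Unary.All using (All; []; _∷_)
import Data.List.Relation.Unary.All as All
import Data.List.Relation.Unary.All.Properties as All
open import Data.List.Relation.Unary.Linked using (Linked; []; [-]; _∷_)
import Data.List.Relation.Unary.Linked as Linked
open import Data.List.Relation.Unary.Linked.Properties using (Linked⇒All)
open import Data.Fin using (Fin)
open import Data.Fin.Properties using (+↔⊎; *↔×)
open import Data.Fin.Permutation using (↔⇒≡)
open import Data.Product using (Σ; Σ-syntax; _×_; _,_; proj₁; proj₂; uncurry)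
import Data.Product as Product
open import Data.Product.Algebra using (×-cong)
open import Data.Product.Function.Dependent.Propositional using (Σ-↔)
open import Data.Sum using (_⊎_; inj₁; inj₂)
open import Data.Sum.Function.Propositional using (_⊎-↔_)
open import Data.Empty using (⊥; ⊥-elim)
open import Function.Base using (flip)
open import Function.Bundles using (_↔_; Inverse; mk↔ₛ′)
open import Function.Properties.Inverse using (↔-refl; ↔-sym; ↔-trans)
open import Function.Related.Propositional using (module EquationalReasoning)
open import Relation.Binary.PropositionalEquality
open import Relation.Nullary using (yes; no)
open import Defs

open Inverse using (to)

-- Weighted bijections and their fibres

Σ-≡-irrelevant : {A : Set} {P : A → Set} → (∀ {x} (p q : P x) → p ≡ q) →
                 {x y : A} {p : P x} {q : P y} → x ≡ y → (x , p) ≡ (y , q)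
Σ-≡-irrelevant P-irrelevant {p = p} {q} refl = cong (_ ,_) (P-irrelevant p q)

Fibre : {A W : Set} → (A → W) → W → Set
Fibre {A} w n = Σ[ x ∈ A ] w x ≡ n

record WeightedBijection {W A B : Set} (wA : A → W) (wB : B → W) : Set where
  constructor mkWeightedBijection
  field
    bijection : A ↔ B
    preserves : ∀ x → wB (to bijection x) ≡ wA x

open WeightedBijection

module _ {W A B : Set} {wA : A → W} {wB : B → W} where

  Fibre-↔ : WeightedBijection wA wB → ∀ n → Fibre wA n ↔ Fibre wB n
  Fibre-↔ e n = Σ-↔ (bijection e) λ {x} →
    subst (λ m → (wA x ≡ n) ↔ (m ≡ n)) (sym (preserves e x)) ↔-refl

  reweigh : {wA′ : A → W} → (∀ x → wA x ≡ wA′ x) →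
            WeightedBijection wA wB → WeightedBijection wA′ wB
  reweigh eq e = mkWeightedBijection (bijection e) λ x → trans (preserves e x) (eq x)

weighted-trans : {W A B C : Set} {wA : A → W} {wB : B → W} {wC : C → W} →
                 WeightedBijection wA wB → WeightedBijection wB wC → WeightedBijection wA wC
weighted-trans e f = mkWeightedBijection (↔-trans (bijection e) (bijection f))
  λ x → trans (preserves f _) (preserves e x)

weighted-× : {A B C D : Set} {wA : A → ℕ} {wB : B → ℕ} {wC : C → ℕ} {wD : D → ℕ} →
             WeightedBijection wA wB → WeightedBijection wC wD →
             WeightedBijection (λ (x : A × C) → wA (proj₁ x) + wC (proj₂ x))
                               (λ (y : B × D) → wB (proj₁ y) + wD (proj₂ y))
weighted-× e f = mkWeightedBijection (×-cong (bijection e) (bijection f))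
  λ (x , z) → cong₂ _+_ (preserves e x) (preserves f z)

weighted-Σ : {W : Set} {A B : ℕ → Set} {wA : ∀ k → A k → W} {wB : ∀ k → B k → W} →
             (∀ k → WeightedBijection (wA k) (wB k)) →
             WeightedBijection (uncurry wA) (uncurry wB)
weighted-Σ e = mkWeightedBijection (Σ-↔ ↔-refl (bijection (e _))) λ (k , x) → preserves (e k) x

Fibre-∸ : {A : Set} {f g : A → ℕ} {k l : ℕ} → (∀ x → f x ≡ g x + k) → k ≤ l →
          Fibre f l ↔ Fibre g (l ∸ k)
Fibre-∸ {f = f} {g} {k} {l} f≡g+k k≤l = Σ-↔ ↔-refl λ {x} → mk↔ₛ′
  (λ fx≡l → trans (sym (m+n∸n≡m (g x) k)) (cong (_∸ k) (trans (sym (f≡g+k x)) fx≡l)))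
  (λ gx≡l∸k → trans (f≡g+k x) (trans (cong (_+ k) gx≡l∸k) (m∸n+n≡m k≤l)))
  (λ _ → ≡-irrelevant _ _) (λ _ → ≡-irrelevant _ _)

Fibre-+ : {A : Set} (f : A → ℕ) (n : ℕ) → Fibre (λ x → + f x) (+ n) ↔ Fibre f n
Fibre-+ f n = Σ-↔ ↔-refl (mk↔ₛ′ ℤ.+-injective (cong (λ m → + m)) (λ { refl → refl }) λ { refl → refl })

Σ≤-syntax : ℕ → (ℕ → Set) → Set
Σ≤-syntax n F = Σ[ l ∈ ℕ ] l ≤ n × F l

syntax Σ≤-syntax n (λ l → F) = Σ[ l ≤ n ] F

Σ≤-cong : ∀ n {F G : ℕ → Set} → (∀ l → l ≤ n → F l ↔ G l) → (Σ[ l ≤ n ] F l) ↔ (Σ[ l ≤ n ] G l)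
Σ≤-cong n e = Σ-↔ ↔-refl λ {l} → Σ-↔ ↔-refl λ {l≤n} → e l l≤n

Σ≤-zero : (F : ℕ → Set) → (Σ[ l ≤ 0 ] F l) ↔ F 0
Σ≤-zero F = mk↔ₛ′ (λ { (.0 , z≤n , x) → x }) (λ x → 0 , z≤n , x) (λ _ → refl) λ { (.0 , z≤n , x) → refl }

Σ≤-suc : ∀ n (F : ℕ → Set) → (Σ[ l ≤ suc n ] F l) ↔ ((Σ[ l ≤ n ] F l) ⊎ F (suc n))
Σ≤-suc n F = mk↔ₛ′ split join split-join join-split
  where
  split : (Σ[ l ≤ suc n ] F l) → (Σ[ l ≤ n ] F l) ⊎ F (suc n)
  split (l , l≤1+n , x) with l ≟ suc n
  ... | yes refl = inj₂ x
  ... | no  l≢1+n = inj₁ (l , ≤-pred (≤∧≢⇒< l≤1+n l≢1+n) , x)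
  join : (Σ[ l ≤ n ] F l) ⊎ F (suc n) → Σ[ l ≤ suc n ] F l
  join (inj₁ (l , l≤n , x)) = l , m≤n⇒m≤1+n l≤n , x
  join (inj₂ x) = suc n , ≤-refl , x
  split-join : ∀ y → split (join y) ≡ y
  split-join (inj₁ (l , l≤n , x)) with l ≟ suc n
  ... | yes refl = ⊥-elim (1+n≰n l≤n)
  ... | no  _    = cong (λ p → inj₁ (l , p , x)) (≤-irrelevant _ _)
  split-join (inj₂ x) with suc n ≟ suc n
  ... | yes refl = refl
  ... | no  1+n≢1+n = ⊥-elim (1+n≢1+n refl)
  join-split : ∀ y → join (split y) ≡ y
  join-split (l , l≤1+n , x) with l ≟ suc n
  ... | yes refl = cong (λ p → suc n , p , x) (≤-irrelevant _ _)
  ... | no  _    = cong (λ p → l , p , x) (≤-irrelevant _ _)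

Σ≤-count : ∀ n {F : ℕ → Set} (f : ℕ → ℕ) → (∀ l → l ≤ n → F l ↔ Fin (f l)) →
           (Σ[ l ≤ n ] F l) ↔ Fin (Σ≤ n f)
Σ≤-count zero    {F} f e = ↔-trans (Σ≤-zero F) (e 0 z≤n)
Σ≤-count (suc n) {F} f e =
  ↔-trans (Σ≤-suc n F)
    (↔-trans (Σ≤-count n f (λ l l≤n → e l (m≤n⇒m≤1+n l≤n)) ⊎-↔ e (suc n) ≤-refl) (↔-sym +↔⊎))

Σkl-count : ∀ n {F : ℕ → ℕ → Set} (f : ℕ → ℕ → ℕ) → (∀ k l → k ≤ l → F k l ↔ Fin (f k l)) →
            (Σ[ l ≤ n ] Σ[ k ≤ l ] F k l) ↔ Fin (Σkl n f)
Σkl-count n f e = Σ≤-count n _ λ l _ → Σ≤-count l _ λ k k≤l → e k l k≤l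

×-count : ∀ {X Y : Set} {m n} → X ↔ Fin m → Y ↔ Fin n → (X × Y) ↔ Fin (m * n)
×-count X↔m Y↔n = ↔-trans (×-cong X↔m Y↔n) (↔-sym *↔×)

module _ {F G : ℕ → Set} (a : ∀ k → F k → ℕ) (b : ∀ k → G k → ℕ) where

  pairWeight : Σ[ k ∈ ℕ ] F k × G k → ℕ
  pairWeight (k , x , y) = a k x + b k y

  Fibre-split : (∀ k x → k ≤ a k x) → ∀ n →
                Fibre pairWeight n ↔ (Σ[ l ≤ n ] Σ[ k ≤ l ] (Fibre (a k) l × Fibre (b k) (n ∸ l)))
  Fibre-split k≤a n = mk↔ₛ′ split join split-join join-split
    where
    Parts : Set
    Parts = Σ[ l ≤ n ] Σ[ k ≤ l ] (Fibre (a k) l × Fibre (b k) (n ∸ l))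
    split : Fibre pairWeight n → Parts
    split ((k , x , y) , e) =
      a k x , subst (a k x ≤_) e (m≤m+n _ _) , k , k≤a k x ,
      (x , refl) , (y , trans (sym (m+n∸m≡n (a k x) _)) (cong (_∸ a k x) e))
    join : Parts → Fibre pairWeight n
    join (l , l≤n , k , _ , (x , p) , (y , q)) = (k , x , y) , trans (cong₂ _+_ p q) (m+[n∸m]≡n l≤n)
    split-join : ∀ z → split (join z) ≡ z
    split-join (l , l≤n , k , k≤l , (x , refl) , (y , q)) =
      cong₂ (λ (l≤n , k≤l) q → l , l≤n , k , k≤l , (x , refl) , (y , q))
            (cong₂ _,_ (≤-irrelevant _ _) (≤-irrelevant _ _)) (≡-irrelevant _ _)
    join-split : ∀ z → join (split z) ≡ z
    join-split (xy , e) = cong (xy ,_) (≡-irrelevant _ _)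

-- Strictly increasing sequences and their gaps

wsum : ∀ {k} → Vec ℕ k → ℕ
wsum [] = 0
wsum {suc k} (g ∷ gs) = suc k * g + wsum gs

tri : ℕ → ℕ
tri zero = 0
tri (suc k) = k + tri k

incWeight : ∀ k → ℕ → Vec ℕ k → ℕ
incWeight k c g = wsum g + k * c + tri k

IncreasingFrom : ℕ → ℕ → Set
IncreasingFrom k c = Σ[ x ∈ Vec ℤ k ] FirstAtLeast (+ c) x × StrictlyIncreasing x

FirstAtLeast-irrelevant : ∀ {m k} {x : Vec ℤ k} (p q : FirstAtLeast m x) → p ≡ q
FirstAtLeast-irrelevant []-fst    []-fst    = refl
FirstAtLeast-irrelevant (∷-fst p) (∷-fst q) = cong ∷-fst (ℤ.≤-irrelevant p q)

StrictlyIncreasing-irrelevant : ∀ {k} {x : Vec ℤ k} (p q : StrictlyIncreasing x) → p ≡ q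
StrictlyIncreasing-irrelevant []-inc      []-inc      = refl
StrictlyIncreasing-irrelevant [-]-inc     [-]-inc     = refl
StrictlyIncreasing-irrelevant (∷-inc p p′) (∷-inc q q′) =
  cong₂ ∷-inc (ℤ.<-irrelevant p q) (StrictlyIncreasing-irrelevant p′ q′)

fromGaps : ∀ {k} → ℕ → Vec ℕ k → Vec ℤ k
fromGaps c []       = []
fromGaps c (g ∷ gs) = + (c + g) ∷ fromGaps (suc (c + g)) gs

toGaps : ∀ {k} c (x : Vec ℤ k) → FirstAtLeast (+ c) x → StrictlyIncreasing x → Vec ℕ k
toGaps c []             _               _                    = []
toGaps c (+ t ∷ [])     (∷-fst (+≤+ _)) _                    = (t ∸ c) ∷ []
toGaps c (+ t ∷ y ∷ xs) (∷-fst (+≤+ _)) (∷-inc (+<+ t<y) inc) =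
  (t ∸ c) ∷ toGaps (suc t) (y ∷ xs) (∷-fst (+≤+ t<y)) inc

fromGaps-atLeast : ∀ {k} c (g : Vec ℕ k) → FirstAtLeast (+ c) (fromGaps c g)
fromGaps-atLeast c []       = []-fst
fromGaps-atLeast c (g ∷ gs) = ∷-fst (+≤+ (m≤m+n c g))

fromGaps-increasing : ∀ {k} c (g : Vec ℕ k) → StrictlyIncreasing (fromGaps c g)
fromGaps-increasing c []            = []-inc
fromGaps-increasing c (g ∷ [])      = [-]-inc
fromGaps-increasing c (g ∷ g′ ∷ gs) =
  ∷-inc (+<+ (s≤s (m≤m+n (c + g) g′))) (fromGaps-increasing (suc (c + g)) (g′ ∷ gs))

vsum-fromGaps : ∀ {k} c (g : Vec ℕ k) → vsum (fromGaps c g) ≡ + incWeight k c g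
vsum-fromGaps c [] = refl
vsum-fromGaps {suc k} c (g ∷ gs) = begin
  + (c + g) ℤ.+ vsum (fromGaps (suc (c + g)) gs)
    ≡⟨ cong (ℤ._+_ (+ (c + g))) (vsum-fromGaps (suc (c + g)) gs) ⟩
  + (c + g + incWeight k (suc (c + g)) gs)
    ≡⟨ cong +_ (shift k c g (wsum gs) (tri k)) ⟩
  + incWeight (suc k) c (g ∷ gs) ∎
  where
  open ≡-Reasoning
  shift : ∀ k c g w t → c + g + (w + k * suc (c + g) + t) ≡ suc k * g + w + suc k * c + (k + t)
  shift = solve-∀

toGaps-fromGaps : ∀ {k} c (g : Vec ℕ k) p q → toGaps c (fromGaps c g) p q ≡ g
toGaps-fromGaps c []            _               _ = refl
toGaps-fromGaps c (g ∷ [])      (∷-fst (+≤+ _)) _ = cong (_∷ []) (m+n∸m≡n c g)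
toGaps-fromGaps c (g ∷ g′ ∷ gs) (∷-fst (+≤+ _)) (∷-inc (+<+ _) q) =
  cong₂ _∷_ (m+n∸m≡n c g) (toGaps-fromGaps (suc (c + g)) (g′ ∷ gs) _ q)

fromGaps-toGaps : ∀ {k} c (x : Vec ℤ k) p q → fromGaps c (toGaps c x p q) ≡ x
fromGaps-toGaps c []             _                 _ = refl
fromGaps-toGaps c (+ t ∷ [])     (∷-fst (+≤+ c≤t)) _ = cong (λ m → + m ∷ []) (m+[n∸m]≡n c≤t)
fromGaps-toGaps c (+ t ∷ y ∷ xs) (∷-fst (+≤+ c≤t)) (∷-inc (+<+ _) q)
  rewrite m+[n∸m]≡n c≤t = cong (+ t ∷_) (fromGaps-toGaps (suc t) (y ∷ xs) _ q)

gap-encoding : ∀ k c →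
  WeightedBijection (λ g → + incWeight k c g) (λ (x : IncreasingFrom k c) → vsum (proj₁ x))
gap-encoding k c = mkWeightedBijection (mk↔ₛ′ encode decode encode-decode decode-encode) (vsum-fromGaps c)
  where
  encode : Vec ℕ k → IncreasingFrom k c
  encode g = fromGaps c g , fromGaps-atLeast c g , fromGaps-increasing c g
  decode : IncreasingFrom k c → Vec ℕ k
  decode (x , p , q) = toGaps c x p q
  encode-decode : ∀ x → encode (decode x) ≡ x
  encode-decode (x , p , q) = Σ-≡-irrelevant
    (λ _ _ → cong₂ _,_ (FirstAtLeast-irrelevant _ _) (StrictlyIncreasing-irrelevant _ _))
    (fromGaps-toGaps c x p q)
  decode-encode : ∀ g → decode (encode g) ≡ g
  decode-encode g = toGaps-fromGaps c g _ _

IncreasingFrom-Fibre : ∀ k c l →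
  (Σ[ x ∈ Vec ℤ k ] FirstAtLeast (+ c) x × StrictlyIncreasing x × vsum x ≡ + l) ↔ Fibre (incWeight k c) l
IncreasingFrom-Fibre k c l =
  ↔-trans reassociate (↔-trans (↔-sym (Fibre-↔ (gap-encoding k c) (+ l))) (Fibre-+ (incWeight k c) l))
  where
  reassociate : (Σ[ x ∈ Vec ℤ k ] FirstAtLeast (+ c) x × StrictlyIncreasing x × vsum x ≡ + l) ↔
                Fibre (λ (x : IncreasingFrom k c) → vsum (proj₁ x)) (+ l)
  reassociate = mk↔ₛ′ (λ (x , p , q , e) → (x , p , q) , e) (λ ((x , p , q) , e) → x , p , q , e)
                      (λ _ → refl) (λ _ → refl)

incWeight-suc : ∀ k c (g : Vec ℕ k) → incWeight k (suc c) g ≡ incWeight k c g + k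
incWeight-suc k c g = lemma (wsum g) k c (tri k)
  where
  lemma : ∀ w k c t → w + k * suc c + t ≡ w + k * c + t + k
  lemma = solve-∀

A↔B : ∀ {k l} → k ≤ l → A k l ↔ B k (l ∸ k)
A↔B {k} {l} k≤l =
  ↔-trans (IncreasingFrom-Fibre k 1 l)
    (↔-trans (Fibre-∸ (incWeight-suc k 0) k≤l) (↔-sym (IncreasingFrom-Fibre k 0 (l ∸ k))))

-- Weakly decreasing lists

≤-head : ∀ {x xs} → Linked _≥_ (x ∷ xs) → All (_≤ x) xs
≤-head [-]         = []
≤-head (y≤x ∷ dec) = Linked⇒All (flip ≤-trans) y≤x dec

decreasing-++ : ∀ m {xs ys} → All (m ≤_) xs → All (_≤ m) ys →
                Linked _≥_ xs → Linked _≥_ ys → Linked _≥_ (xs ++ ys)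
decreasing-++ m {[]}         _             _          _          dys = dys
decreasing-++ m {x ∷ []}     _             []         _          _   = [-]
decreasing-++ m {x ∷ []}     (m≤x ∷ _)     (y≤m ∷ _)  _          dys = ≤-trans y≤m m≤x ∷ dys
decreasing-++ m {x ∷ y ∷ xs} (_ ∷ m≤xs)    ys≤m       (y≤x ∷ dxs) dys =
  y≤x ∷ decreasing-++ m m≤xs ys≤m dxs dys

decreasing-++⁻ : ∀ xs {ys} → Linked _≥_ (xs ++ ys) → Linked _≥_ xs × Linked _≥_ ys
decreasing-++⁻ []           dec         = [] , dec
decreasing-++⁻ (x ∷ [])     dec         = [-] , Linked.tail dec
decreasing-++⁻ (x ∷ y ∷ xs) (y≤x ∷ dec) = Product.map₁ (y≤x ∷_) (decreasing-++⁻ (y ∷ xs) dec)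

All-replicate : ∀ {P : ℕ → Set} m {v} → P v → All P (replicate m v)
All-replicate zero    _  = []
All-replicate (suc m) pv = pv ∷ All-replicate m pv

replicate-decreasing : ∀ m v → Linked _≥_ (replicate m v)
replicate-decreasing zero          v = []
replicate-decreasing (suc zero)    v = [-]
replicate-decreasing (suc (suc m)) v = ≤-refl ∷ replicate-decreasing (suc m) v

sum-reverse : ∀ {k} (v : Vec ℕ k) → sum (toList (reverse v)) ≡ sum (toList v)
sum-reverse v = trans (cong sum (toList-reverse v)) (sum-↭ (↭-reverse (toList v)))

wsum-∷ʳ : ∀ {k} (v : Vec ℕ k) x → wsum (v ∷ʳ x) ≡ wsum v + sum (toList v) + x
wsum-∷ʳ [] x = lemma x
  where
  lemma : ∀ x → 1 * x + 0 ≡ 0 + 0 + x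
  lemma = solve-∀
wsum-∷ʳ {suc k} (y ∷ v) x =
  trans (cong (_+_ (suc (suc k) * y)) (wsum-∷ʳ v x)) (lemma k y (wsum v) (sum (toList v)) x)
  where
  lemma : ∀ k y w s x → suc (suc k) * y + (w + s + x) ≡ suc k * y + w + (y + s) + x
  lemma = solve-∀

DecreasingAbove : ℕ → List ℕ → Set
DecreasingAbove c xs = Linked _≥_ xs × All (c ≤_) xs

DecreasingAbove-irrelevant : ∀ {c xs} (p q : DecreasingAbove c xs) → p ≡ q
DecreasingAbove-irrelevant (dec , geq) (dec′ , geq′) =
  cong₂ _,_ (Linked.irrelevant ≤-irrelevant dec dec′) (All.irrelevant ≤-irrelevant geq geq′)

Rows : ℕ → ℕ → Set
Rows k c = Σ[ v ∈ Vec ℕ k ] DecreasingAbove c (toList v)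

rowsSize : ∀ {k c} → Rows k c → ℕ
rowsSize (v , _) = sum (toList v)

headOr : ∀ {k} → ℕ → Vec ℕ k → ℕ
headOr c []      = c
headOr c (x ∷ _) = x

rowsFrom : ∀ {k} → ℕ → Vec ℕ k → Vec ℕ k
rowsFrom c []       = []
rowsFrom c (t ∷ ts) = t + headOr c (rowsFrom c ts) ∷ rowsFrom c ts

differences : ∀ {k} → ℕ → Vec ℕ k → Vec ℕ k
differences c []       = []
differences c (x ∷ xs) = x ∸ headOr c xs ∷ differences c xs

c≤headOr : ∀ {k c} (v : Vec ℕ k) → All (c ≤_) (toList v) → c ≤ headOr c v
c≤headOr []      _         = ≤-refl
c≤headOr (x ∷ v) (c≤x ∷ _) = c≤x

headOr≤head : ∀ {k c} x (v : Vec ℕ k) → Linked _≥_ (toList (x ∷ v)) → All (c ≤_) (toList (x ∷ v)) →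
              headOr c v ≤ x
headOr≤head x []      _         (c≤x ∷ _) = c≤x
headOr≤head x (y ∷ v) (y≤x ∷ _) _         = y≤x

rowsFrom-decreasing : ∀ {k} c (t : Vec ℕ k) → Linked _≥_ (toList (rowsFrom c t))
rowsFrom-decreasing c []            = []
rowsFrom-decreasing c (t ∷ [])      = [-]
rowsFrom-decreasing c (t ∷ t′ ∷ ts) = m≤n+m _ t ∷ rowsFrom-decreasing c (t′ ∷ ts)

rowsFrom-atLeast : ∀ {k} c (t : Vec ℕ k) → All (c ≤_) (toList (rowsFrom c t))
rowsFrom-atLeast c []       = []
rowsFrom-atLeast c (t ∷ ts) =
  ≤-trans (c≤headOr (rowsFrom c ts) rest) (m≤n+m _ t) ∷ rest
  where
  rest : All (c ≤_) (toList (rowsFrom c ts))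
  rest = rowsFrom-atLeast c ts

differences-rowsFrom : ∀ {k} c (t : Vec ℕ k) → differences c (rowsFrom c t) ≡ t
differences-rowsFrom c []       = refl
differences-rowsFrom c (t ∷ ts) =
  cong₂ _∷_ (m+n∸n≡m t (headOr c (rowsFrom c ts))) (differences-rowsFrom c ts)

rowsFrom-differences : ∀ {k} c (v : Vec ℕ k) → Linked _≥_ (toList v) → All (c ≤_) (toList v) →
                       rowsFrom c (differences c v) ≡ v
rowsFrom-differences c []      _   _   = refl
rowsFrom-differences c (x ∷ v) dec geq
  rewrite rowsFrom-differences c v (Linked.tail dec) (All.tail geq) =
  cong (_∷ v) (m∸n+n≡m (headOr≤head x v dec geq))

headOr-rowsFrom : ∀ {k} c (t : Vec ℕ k) → headOr c (rowsFrom c t) ≡ c + sum (toList t)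
headOr-rowsFrom c []       = sym (+-identityʳ c)
headOr-rowsFrom c (t ∷ ts) = trans (cong (_+_ t) (headOr-rowsFrom c ts)) (+-comm-middle t c _)
  where
  +-comm-middle : ∀ a b d → a + (b + d) ≡ b + (a + d)
  +-comm-middle = solve-∀

sum-rowsFrom : ∀ {k} c (t : Vec ℕ k) → sum (toList (rowsFrom c t)) ≡ k * c + wsum (reverse t)
sum-rowsFrom c [] = refl
sum-rowsFrom {suc k} c (t ∷ ts) = begin
  t + headOr c (rowsFrom c ts) + sum (toList (rowsFrom c ts))
    ≡⟨ cong₂ (λ h s → t + h + s) (headOr-rowsFrom c ts) (sum-rowsFrom c ts) ⟩
  t + (c + sum (toList ts)) + (k * c + wsum (reverse ts))
    ≡⟨ lemma t c (sum (toList ts)) k (wsum (reverse ts)) ⟩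
  suc k * c + (wsum (reverse ts) + sum (toList ts) + t)
    ≡⟨ cong (λ s → suc k * c + (wsum (reverse ts) + s + t)) (sum-reverse ts) ⟨
  suc k * c + (wsum (reverse ts) + sum (toList (reverse ts)) + t)
    ≡⟨ cong (_+_ (suc k * c)) (wsum-∷ʳ (reverse ts) t) ⟨
  suc k * c + wsum (reverse ts ∷ʳ t)
    ≡⟨ cong (λ v → suc k * c + wsum v) (reverse-∷ t ts) ⟨
  suc k * c + wsum (reverse (t ∷ ts)) ∎
  where
  open ≡-Reasoning
  lemma : ∀ t c s k w → t + (c + s) + (k * c + w) ≡ suc k * c + (w + s + t)
  lemma = solve-∀

-- rowsFrom counts its i-th entry i times and wsum counts its i-th entry k + 1 − i times.
rows-encoding : ∀ k c → WeightedBijection (λ g → k * c + wsum g) (rowsSize {k} {c})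
rows-encoding k c = mkWeightedBijection (mk↔ₛ′ encode decode encode-decode decode-encode) size
  where
  encode : Vec ℕ k → Rows k c
  encode g = rowsFrom c (reverse g) , rowsFrom-decreasing c (reverse g) , rowsFrom-atLeast c (reverse g)
  decode : Rows k c → Vec ℕ k
  decode (v , _) = reverse (differences c v)
  encode-decode : ∀ r → encode (decode r) ≡ r
  encode-decode (v , dec , geq) = Σ-≡-irrelevant DecreasingAbove-irrelevant
    (trans (cong (rowsFrom c) (reverse-involutive _)) (rowsFrom-differences c v dec geq))
  decode-encode : ∀ g → decode (encode g) ≡ g
  decode-encode g = trans (cong reverse (differences-rowsFrom c (reverse g))) (reverse-involutive g)
  size : ∀ g → sum (toList (rowsFrom c (reverse g))) ≡ k * c + wsum g
  size g = trans (sum-rowsFrom c (reverse g)) (cong (λ v → k * c + wsum v) (reverse-involutive g))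

IsBoundedPartition : ℕ → List ℕ → Set
IsBoundedPartition k b = All (λ x → x ≥ 1) b × Linked _≥_ b × All (_≤ k) b

IsBoundedPartition-irrelevant : ∀ {k b} (p q : IsBoundedPartition k b) → p ≡ q
IsBoundedPartition-irrelevant (pos , dec , ≤k) (pos′ , dec′ , ≤k′) =
  cong₂ _,_ (All.irrelevant ≤-irrelevant pos pos′)
            (cong₂ _,_ (Linked.irrelevant ≤-irrelevant dec dec′) (All.irrelevant ≤-irrelevant ≤k ≤k′))

BoundedPartition : ℕ → Set
BoundedPartition k = Σ (List ℕ) (IsBoundedPartition k)

boundedSize : ∀ {k} → BoundedPartition k → ℕ
boundedSize (b , _) = sum b

withMultiplicities : ∀ {k} → Vec ℕ k → List ℕ
withMultiplicities []                = []
withMultiplicities {suc k} (m ∷ ms) = replicate m (suc k) ++ withMultiplicities ms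

stripCopies : ℕ → List ℕ → ℕ × List ℕ
stripCopies v []       = 0 , []
stripCopies v (x ∷ xs) with x ≟ v
... | yes _ = Product.map₁ suc (stripCopies v xs)
... | no  _ = 0 , x ∷ xs

multiplicities : ∀ k → List ℕ → Vec ℕ k
multiplicities zero    _ = []
multiplicities (suc k) b = let (m , r) = stripCopies (suc k) b in m ∷ multiplicities k r

withMultiplicities-bounded : ∀ {k} (ms : Vec ℕ k) → IsBoundedPartition k (withMultiplicities ms)
withMultiplicities-bounded [] = [] , [] , []
withMultiplicities-bounded {suc k} (m ∷ ms) with withMultiplicities-bounded ms
... | pos , dec , ≤k =
  All.++⁺ (All-replicate m (s≤s z≤n)) pos ,
  decreasing-++ (suc k) (All-replicate m ≤-refl) ≤1+k (replicate-decreasing m (suc k)) dec ,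
  All.++⁺ (All-replicate m ≤-refl) ≤1+k
  where
  ≤1+k : All (_≤ suc k) (withMultiplicities ms)
  ≤1+k = All.map m≤n⇒m≤1+n ≤k

stripCopies-replicate : ∀ {k} m r → All (_≤ k) r →
                        stripCopies (suc k) (replicate m (suc k) ++ r) ≡ (m , r)
stripCopies-replicate {k} zero []      _          = refl
stripCopies-replicate {k} zero (y ∷ r) (y≤k ∷ _) with y ≟ suc k
... | yes refl = ⊥-elim (1+n≰n y≤k)
... | no  _    = refl
stripCopies-replicate {k} (suc m) r ≤k with suc k ≟ suc k
... | yes _ = cong (Product.map₁ suc) (stripCopies-replicate m r ≤k)
... | no  ≢ = ⊥-elim (≢ refl)

stripCopies-split : ∀ {k} b → IsBoundedPartition (suc k) b →
                    let (m , r) = stripCopies (suc k) b in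
                    replicate m (suc k) ++ r ≡ b × IsBoundedPartition k r
stripCopies-split []       _ = refl , [] , [] , []
stripCopies-split {k} (x ∷ xs) (pos ∷ poss , dec , x≤1+k ∷ xs≤1+k) with x ≟ suc k
... | yes refl = Product.map₁ (cong (suc k ∷_)) (stripCopies-split xs (poss , Linked.tail dec , xs≤1+k))
... | no  x≢1+k = refl , pos ∷ poss , dec , x≤k ∷ All.map (λ y≤x → ≤-trans y≤x x≤k) (≤-head dec)
  where
  x≤k : x ≤ k
  x≤k = ≤-pred (≤∧≢⇒< x≤1+k x≢1+k)

multiplicities-withMultiplicities : ∀ {k} (ms : Vec ℕ k) → multiplicities k (withMultiplicities ms) ≡ ms
multiplicities-withMultiplicities [] = refl
multiplicities-withMultiplicities {suc k} (m ∷ ms)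
  rewrite stripCopies-replicate m (withMultiplicities ms) (proj₂ (proj₂ (withMultiplicities-bounded ms))) =
  cong (m ∷_) (multiplicities-withMultiplicities ms)

withMultiplicities-multiplicities : ∀ k b → IsBoundedPartition k b →
                                    withMultiplicities (multiplicities k b) ≡ b
withMultiplicities-multiplicities zero    []      _                    = refl
withMultiplicities-multiplicities zero    (x ∷ b) (1≤x ∷ _ , _ , x≤0 ∷ _) = ⊥-elim (<⇒≱ 1≤x x≤0)
withMultiplicities-multiplicities (suc k) b       bounded
  with stripCopies (suc k) b | stripCopies-split b bounded
... | m , r | b≡ , r-bounded =
  trans (cong (replicate m (suc k) ++_) (withMultiplicities-multiplicities k r r-bounded)) b≡

sum-replicate : ∀ m v → sum (replicate m v) ≡ m * v
sum-replicate zero    v = refl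
sum-replicate (suc m) v = cong (_+_ v) (sum-replicate m v)

sum-withMultiplicities : ∀ {k} (ms : Vec ℕ k) → sum (withMultiplicities ms) ≡ wsum ms
sum-withMultiplicities [] = refl
sum-withMultiplicities {suc k} (m ∷ ms) = begin
  sum (replicate m (suc k) ++ withMultiplicities ms)
    ≡⟨ sum-++ (replicate m (suc k)) _ ⟩
  sum (replicate m (suc k)) + sum (withMultiplicities ms)
    ≡⟨ cong₂ _+_ (sum-replicate m (suc k)) (sum-withMultiplicities ms) ⟩
  m * suc k + wsum ms
    ≡⟨ cong (_+ wsum ms) (*-comm m (suc k)) ⟩
  suc k * m + wsum ms ∎
  where open ≡-Reasoning

multiplicity-encoding : ∀ k → WeightedBijection wsum (boundedSize {k})
multiplicity-encoding k =
  mkWeightedBijection (mk↔ₛ′ encode decode encode-decode decode-encode) sum-withMultiplicities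
  where
  encode : Vec ℕ k → BoundedPartition k
  encode ms = withMultiplicities ms , withMultiplicities-bounded ms
  decode : BoundedPartition k → Vec ℕ k
  decode (b , _) = multiplicities k b
  encode-decode : ∀ b → encode (decode b) ≡ b
  encode-decode (b , bounded) =
    Σ-≡-irrelevant IsBoundedPartition-irrelevant (withMultiplicities-multiplicities k b bounded)
  decode-encode : ∀ ms → decode (encode ms) ≡ ms
  decode-encode = multiplicities-withMultiplicities

-- The Durfee decomposition

IsPartition : List ℕ → Set
IsPartition xs = All (λ x → x ≥ 1) xs × Linked _≥_ xs

IsPartition-irrelevant : ∀ {xs} (p q : IsPartition xs) → p ≡ q
IsPartition-irrelevant (pos , dec) (pos′ , dec′) =
  cong₂ _,_ (All.irrelevant ≤-irrelevant pos pos′) (Linked.irrelevant ≤-irrelevant dec dec′)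

Partitions : Set
Partitions = Σ (List ℕ) IsPartition

size : Partitions → ℕ
size (xs , _) = sum xs

DurfeeForm : Set
DurfeeForm = Σ[ k ∈ ℕ ] Rows k k × BoundedPartition k

durfeeSize : DurfeeForm → ℕ
durfeeSize (_ , r , b) = rowsSize r + boundedSize b

rows-positive : ∀ {k} (v : Vec ℕ k) → All (k ≤_) (toList v) → All (λ x → x ≥ 1) (toList v)
rows-positive []      _   = []
rows-positive (x ∷ v) k≤v = All.map (≤-trans (s≤s z≤n)) k≤v

bounds-disjoint : ∀ i {j y} → i + suc j ≤ y → y ≤ i + 0 → ⊥
bounds-disjoint i {j} i+j<y y≤i with +-cancelˡ-≤ i (suc j) 0 (≤-trans i+j<y y≤i)
... | ()

-- i counts the rows already split off, so the Durfee side is i + side.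
record DurfeeSplit (i : ℕ) (xs : List ℕ) : Set where
  field
    side    : ℕ
    rows    : Vec ℕ side
    rest    : List ℕ
    concat  : toList rows ++ rest ≡ xs
    rows≥   : All (i + side ≤_) (toList rows)
    rest≤   : All (_≤ i + side) rest

open DurfeeSplit

durfeeSplit : ∀ i xs → Linked _≥_ xs → DurfeeSplit i xs
durfeeSplit i []       _   =
  record { side = 0 ; rows = [] ; rest = [] ; concat = refl ; rows≥ = [] ; rest≤ = [] }
durfeeSplit i (x ∷ xs) dec with suc i ≤? x
... | no  i≮x = record
  { side = 0 ; rows = [] ; rest = x ∷ xs ; concat = refl ; rows≥ = []
  ; rest≤ = x≤i ∷ All.map (λ y≤x → ≤-trans y≤x x≤i) (≤-head dec) }
  where
  x≤i : x ≤ i + 0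
  x≤i = subst (x ≤_) (sym (+-identityʳ i)) (≮⇒≥ i≮x)
... | yes i<x = record
  { side   = suc (side s)
  ; rows   = x ∷ rows s
  ; rest   = rest s
  ; concat = cong (x ∷_) (concat s)
  ; rows≥  = subst (_≤ x) i+j≡ (side≤x (rows s) (rows≥ s) rows≤x)
             ∷ subst (λ m → All (m ≤_) (toList (rows s))) i+j≡ (rows≥ s)
  ; rest≤  = subst (λ m → All (_≤ m) (rest s)) i+j≡ (rest≤ s)
  }
  where
  s : DurfeeSplit (suc i) xs
  s = durfeeSplit (suc i) xs (Linked.tail dec)
  i+j≡ : suc i + side s ≡ i + suc (side s)
  i+j≡ = sym (+-suc i (side s))
  rows≤x : All (_≤ x) (toList (rows s))
  rows≤x = All.++⁻ˡ (toList (rows s)) (subst (All (_≤ x)) (sym (concat s)) (≤-head dec))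
  side≤x : ∀ {j} (v : Vec ℕ j) → All (suc i + j ≤_) (toList v) → All (_≤ x) (toList v) → suc i + j ≤ x
  side≤x []      _         _         = subst (_≤ x) (sym (+-identityʳ (suc i))) i<x
  side≤x (y ∷ _) (j≤y ∷ _) (y≤x ∷ _) = ≤-trans j≤y y≤x

durfeeSplit-unique : ∀ i {j j′} (v : Vec ℕ j) (v′ : Vec ℕ j′) {b b′} →
  toList v ++ b ≡ toList v′ ++ b′ →
  All (i + j ≤_) (toList v) → All (_≤ i + j) b → All (i + j′ ≤_) (toList v′) → All (_≤ i + j′) b′ →
  _≡_ {A = Σ[ j ∈ ℕ ] Vec ℕ j × List ℕ} (j , v , b) (j′ , v′ , b′)
durfeeSplit-unique i []      []       eq _ _ _ _ = cong (λ b → 0 , [] , b) eq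
durfeeSplit-unique i []      (y ∷ v′) refl _ (y≤i ∷ _) (i<y ∷ _) _ = ⊥-elim (bounds-disjoint i i<y y≤i)
durfeeSplit-unique i (x ∷ v) []       refl (i<x ∷ _) _ _ (x≤i ∷ _) = ⊥-elim (bounds-disjoint i i<x x≤i)
durfeeSplit-unique i {suc j} {suc j′} (x ∷ v) (y ∷ v′) eq (_ ∷ v≥) b≤ (_ ∷ v′≥) b′≤
  rewrite +-suc i j | +-suc i j′
  with ∷-injective eq
... | refl , eq′ with durfeeSplit-unique (suc i) v v′ eq′ v≥ b≤ v′≥ b′≤
... | refl = refl

shape : DurfeeForm → Σ[ k ∈ ℕ ] Vec ℕ k × List ℕ
shape (k , (v , _) , (b , _)) = k , v , b

shape-injective : ∀ {y y′} → shape y ≡ shape y′ → y ≡ y′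
shape-injective {k , (v , r) , (b , p)} {.k , (.v , r′) , (.b , p′)} refl =
  cong₂ (λ r p → k , (v , r) , (b , p))
        (DecreasingAbove-irrelevant r r′) (IsBoundedPartition-irrelevant p p′)

durfee-decomposition : WeightedBijection durfeeSize size
durfee-decomposition = mkWeightedBijection (mk↔ₛ′ join decompose join-decompose decompose-join) join-size
  where
  join : DurfeeForm → Partitions
  join (k , (v , dec , k≤v) , (b , pos , decb , b≤k)) =
    toList v ++ b , All.++⁺ (rows-positive v k≤v) pos , decreasing-++ k k≤v b≤k dec decb
  decompose : Partitions → DurfeeForm
  decompose (xs , pos , dec) =
    side s ,
    (rows s , proj₁ parts , rows≥ s) ,
    (rest s , All.++⁻ʳ (toList (rows s)) pos′ , proj₂ parts , rest≤ s)
    where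
    s : DurfeeSplit 0 xs
    s = durfeeSplit 0 xs dec
    parts : Linked _≥_ (toList (rows s)) × Linked _≥_ (rest s)
    parts = decreasing-++⁻ (toList (rows s)) (subst (Linked _≥_) (sym (concat s)) dec)
    pos′ : All (λ x → x ≥ 1) (toList (rows s) ++ rest s)
    pos′ = subst (All (λ x → x ≥ 1)) (sym (concat s)) pos
  join-decompose : ∀ x → join (decompose x) ≡ x
  join-decompose (xs , pos , dec) = Σ-≡-irrelevant IsPartition-irrelevant (concat (durfeeSplit 0 xs dec))
  decompose-join : ∀ y → decompose (join y) ≡ y
  decompose-join y@(k , (v , _ , k≤v) , (b , _ , _ , b≤k)) =
    shape-injective (durfeeSplit-unique 0 (rows s) v (concat s) (rows≥ s) (rest≤ s) k≤v b≤k)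
    where
    s : DurfeeSplit 0 (toList v ++ b)
    s = durfeeSplit 0 (toList v ++ b) (proj₂ (proj₂ (join y)))
  join-size : ∀ y → size (join y) ≡ durfeeSize y
  join-size (k , (v , _) , (b , _)) = sum-++ (toList v) b

square≡k+tri+tri : ∀ k → k * k ≡ k + tri k + tri k
square≡k+tri+tri zero    = refl
square≡k+tri+tri (suc k) = begin
  suc k * suc k                     ≡⟨ lemma₁ k ⟩
  suc (k * k + k + k)               ≡⟨ cong (λ s → suc (s + k + k)) (square≡k+tri+tri k) ⟩
  suc (k + tri k + tri k + k + k)   ≡⟨ lemma₂ k (tri k) ⟩
  suc k + tri (suc k) + tri (suc k) ∎
  where
  open ≡-Reasoning
  lemma₁ : ∀ k → suc k * suc k ≡ suc (k * k + k + k)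
  lemma₁ = solve-∀
  lemma₂ : ∀ k t → suc (k + t + t + k + k) ≡ suc k + (k + t) + (k + t)
  lemma₂ = solve-∀

durfeeWeight : Σ[ k ∈ ℕ ] Vec ℕ k × Vec ℕ k → ℕ
durfeeWeight = pairWeight (λ k → incWeight k 1) (λ k → incWeight k 0)

square-split : ∀ k (gh : Vec ℕ k × Vec ℕ k) →
               k * k + wsum (proj₁ gh) + wsum (proj₂ gh) ≡ durfeeWeight (k , gh)
square-split k (g , h) =
  trans (cong (λ s → s + wsum g + wsum h) (square≡k+tri+tri k)) (lemma k (tri k) (wsum g) (wsum h))
  where
  lemma : ∀ k t a b → k + t + t + a + b ≡ (a + k * 1 + t) + (b + k * 0 + t)
  lemma = solve-∀

durfee-encoding : WeightedBijection durfeeWeight size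
durfee-encoding = weighted-trans
  (weighted-Σ λ k → reweigh (square-split k) (weighted-× (rows-encoding k k) (multiplicity-encoding k)))
  durfee-decomposition

k≤incWeight : ∀ k (g : Vec ℕ k) → k ≤ incWeight k 1 g
k≤incWeight k g =
  subst (_≤ incWeight k 1 g) (*-identityʳ k) (≤-trans (m≤n+m (k * 1) (wsum g)) (m≤m+n _ (tri k)))

Partition↔Fibre : ∀ n → Partition n ↔ Fibre size n
Partition↔Fibre n = mk↔ₛ′ (λ (xs , pos , dec , e) → (xs , pos , dec) , e)
                          (λ ((xs , pos , dec) , e) → xs , pos , dec , e)
                          (λ _ → refl) (λ _ → refl)

Partition-decomposition : ∀ n → Partition n ↔ (Σ[ l ≤ n ] Σ[ k ≤ l ] (A k l × B k (n ∸ l)))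
Partition-decomposition n = begin
  Partition n
    ↔⟨ Partition↔Fibre n ⟩
  Fibre size n
    ↔⟨ Fibre-↔ durfee-encoding n ⟨
  Fibre durfeeWeight n
    ↔⟨ Fibre-split (λ k → incWeight k 1) (λ k → incWeight k 0) k≤incWeight n ⟩
  (Σ[ l ≤ n ] Σ[ k ≤ l ] (Fibre (incWeight k 1) l × Fibre (incWeight k 0) (n ∸ l)))
    ↔⟨ Σ≤-cong n (λ l _ → Σ≤-cong l λ k _ →
         ×-cong (IncreasingFrom-Fibre k 1 l) (IncreasingFrom-Fibre k 0 (n ∸ l))) ⟨
  (Σ[ l ≤ n ] Σ[ k ≤ l ] (A k l × B k (n ∸ l))) ∎
  where open EquationalReasoning

lemma3p2 : (n : ℕ) (a b : ℕ → ℕ → ℕ) (p : ℕ) →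
           (∀ k l → A k l ↔ Fin (a k l)) →
           (∀ k l → B k l ↔ Fin (b k l)) →
           (Partition n ↔ Fin p) →
           (p ≡ Σkl n (λ k l → a k l * b k (n ∸ l)))
           × (p ≡ Σkl n (λ k l → b k (l ∸ k) * b k (n ∸ l)))
lemma3p2 n a b p A↔a B↔b P↔p =
  ↔⇒≡ (counted λ k l _ → ×-count (A↔a k l) (B↔b k (n ∸ l))) ,
  ↔⇒≡ (counted λ k l k≤l → ×-count (↔-trans (A↔B k≤l) (B↔b k (l ∸ k))) (B↔b k (n ∸ l)))
  where
  counted : ∀ {f} → (∀ k l → k ≤ l → (A k l × B k (n ∸ l)) ↔ Fin (f k l)) → Fin p ↔ Fin (Σkl n f)
  counted e = ↔-trans (↔-sym P↔p) (↔-trans (Partition-decomposition n) (Σkl-count n _ e))
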